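{- Let $m\ge 3$ be an odd integer and $n$ an even positive integer, and let $X=\{x_{i,j}\}$ be a $C_4$-face-magic Klein bottle labeling of $\mathcal{K}_{m,n}$. Then $X$ is equatorially balanced, i.e. $x_{i,j}+x_{i,n+1-j}=mn+1$ for all $1\le i\le m$ and $1\le j\le n/2$.
   Context: The $m\times n$ Klein bottle grid graph $\mathcal{K}_{m,n}$ has vertex set $\{(i,j):1\le i\le m,\ 1\le j\le n\}$ and edges $(i,j)(i,j+1)$ for $1\le j\le n-1$; $(i,n)(i,1)$; $(i,j)(i+1,j)$ for $1\le i\le m-1$; and $(m,j)(1,n+1-j)$ for $1\le j\le n$. Its $4$-cycle faces in the natural Klein bottle embedding are, with column indices modulo $n$, $\{(i,j),(i,j+1),(i+1,j),(i+1,j+1)\}$ for $1\le i\le m-1$, $1\le j\le n$, and $\{(m,j),(m,j+1),(1,n+1-j),(1,n-j)\}$ for $1\le j\le n$. A $C_4$-face-magic Klein bottle labeling is a bijection $(i,j)\mapsto x_{i,j}$ onto $\{1,\dots,mn\}$ such that the label sum over every such face equals a common constant $S$ (for $n$ even this constant is $2(mn+1)$). Such a labeling is called equatorially balanced if $x_{i,j}+x_{i,n+1-j}=\tfrac12 S=mn+1$ for all $1\le i\le m$, $1\le j\le n/2$. -}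

module Defs where

open import Data.Nat using (ℕ; zero; suc; _+_; _*_; _∸_; _≤_; _≟_)
open import Data.Product using (Σ; _×_; ∃; _,_)
open import Relation.Nullary using (yes; no)
open import Relation.Binary.PropositionalEquality using (_≡_)

-- Conventions: vertices (i , j) are 1-based, 1 ≤ i ≤ m, 1 ≤ j ≤ n, as in the paper.
-- A labeling is a function x : ℕ → ℕ → ℕ; only the values x i j with
-- 1 ≤ i ≤ m, 1 ≤ j ≤ n are relevant.

nextCol : ℕ → ℕ → ℕ
nextCol n j with j ≟ n
... | yes _ = 1
... | no  _ = suc j

oppPrevCol : ℕ → ℕ → ℕ
oppPrevCol n j with n ∸ j
... | zero  = n
... | suc k = suc k

IsBijectiveLabeling : ℕ → ℕ → (ℕ → ℕ → ℕ) → Set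
IsBijectiveLabeling m n x =
  (∀ i j → 1 ≤ i → i ≤ m → 1 ≤ j → j ≤ n → 1 ≤ x i j × x i j ≤ m * n)
  × (∀ i j i' j' → 1 ≤ i → i ≤ m → 1 ≤ j → j ≤ n
                 → 1 ≤ i' → i' ≤ m → 1 ≤ j' → j' ≤ n
                 → x i j ≡ x i' j' → (i ≡ i' × j ≡ j'))
  × (∀ k → 1 ≤ k → k ≤ m * n →
       ∃ λ i → ∃ λ j → 1 ≤ i × i ≤ m × 1 ≤ j × j ≤ n × x i j ≡ k)

-- every 4-cycle face of the natural Klein bottle embedding of K_{m,n} has label sum S
FacesHaveSum : ℕ → ℕ → (ℕ → ℕ → ℕ) → ℕ → Set
FacesHaveSum m n x S =
  (∀ i j → 1 ≤ i → i ≤ m ∸ 1 → 1 ≤ j → j ≤ n →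
     x i j + x i (nextCol n j) + x (suc i) j + x (suc i) (nextCol n j) ≡ S)
  × (∀ j → 1 ≤ j → j ≤ n →
     x m j + x m (nextCol n j) + x 1 (n + 1 ∸ j) + x 1 (oppPrevCol n j) ≡ S)

IsC4FaceMagicKleinLabeling : ℕ → ℕ → (ℕ → ℕ → ℕ) → Set
IsC4FaceMagicKleinLabeling m n x =
  IsBijectiveLabeling m n x × ∃ λ S → FacesHaveSum m n x S

IsEquatoriallyBalanced : ℕ → ℕ → (ℕ → ℕ → ℕ) → Set
IsEquatoriallyBalanced m n x =
  ∀ i j → 1 ≤ i → i ≤ m → 1 ≤ j → 2 * j ≤ n → x i j + x i (n + 1 ∸ j) ≡ m * n + 1

-- Write A i j = x(i,j) + x(i,j+1) for the label sum of a horizontal edge. The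
-- interior faces say A i j + A (i+1) j = S and the twisted faces say
-- A m j + A 1 (n-j) = S, so the sums P i j = A i j + A i (n-j) satisfy
-- P i j + P (i+1) j = 2S around the cycle of rows. That cycle has odd length m,
-- hence P i j = S for every i. Within a row, P i j = S says that the mirror sums
-- b j = x(i,j) + x(i,n+1-j) satisfy b j + b (j+1) = S, and b (n/2) = b (n/2+1);
-- so every mirror sum is S/2. Comparing the mirror sums through the cells
-- labelled 1 and mn shows that this common value is mn + 1.
module Submission where

open import Defs
open import Data.Nat using (ℕ; zero; suc; _+_; _*_; _∸_; _≤_; _<_; _≟_; z≤n; s≤s; s≤s⁻¹)
open import Data.Nat.Properties
open import Data.Product using (∃; _×_; _,_; proj₁; proj₂)
open import Data.Sum using (inj₁; inj₂)
open import Data.Empty using (⊥-elim)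
open import Relation.Nullary using (yes; no)
open import Relation.Binary.PropositionalEquality
open import Algebra.Properties.CommutativeSemigroup +-commutativeSemigroup using (interchange)

+-self-injective : ∀ {a b} → a + a ≡ b + b → a ≡ b
+-self-injective {a} {b} eq = *-cancelˡ-≡ a b 2
  (trans (cong (a +_) (+-identityʳ a)) (trans eq (sym (cong (b +_) (+-identityʳ b)))))

nextCol-< : ∀ {n j} → j < n → nextCol n j ≡ suc j
nextCol-< {n} {j} j<n with j ≟ n
... | yes refl = ⊥-elim (<-irrefl refl j<n)
... | no _ = refl

oppPrevCol-< : ∀ {n j} → j < n → oppPrevCol n j ≡ n ∸ j
oppPrevCol-< {n} {j} j<n with n ∸ j in eq
... | zero = ⊥-elim (<-irrefl refl (<-≤-trans j<n (m∸n≡0⇒m≤n eq)))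
... | suc _ = refl

AdjacentSums : (ℕ → ℕ) → ℕ → ℕ → ℕ → Set
AdjacentSums f T lo hi = ∀ j → lo ≤ j → j < hi → f j + f (suc j) ≡ T

module _ {f : ℕ → ℕ} {T lo hi : ℕ} (adj : AdjacentSums f T lo hi) where

  adjacent-two-step : ∀ {j} → lo ≤ j → suc (suc j) ≤ hi → f (suc (suc j)) ≡ f j
  adjacent-two-step {j} lo≤j ssj≤hi = +-cancelˡ-≡ (f (suc j)) _ _
    (trans (adj (suc j) (m≤n⇒m≤1+n lo≤j) ssj≤hi)
      (trans (sym (adj j lo≤j (<⇒≤ ssj≤hi))) (+-comm (f j) (f (suc j)))))

  adjacent-period-2 : ∀ d → 2 * d + lo ≤ hi → f (2 * d + lo) ≡ f lo
  adjacent-period-2 zero _ = refl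
  adjacent-period-2 (suc d) h =
    trans (cong f 2[1+d]+lo≡)
      (trans (adjacent-two-step (m≤n+m lo (2 * d)) h′) (adjacent-period-2 d (<⇒≤ (<⇒≤ h′))))
    where
      2[1+d]+lo≡ : 2 * suc d + lo ≡ suc (suc (2 * d + lo))
      2[1+d]+lo≡ = cong (_+ lo) (*-suc 2 d)
      h′ = subst (_≤ hi) 2[1+d]+lo≡ h

  adjacent-constant : f lo + f lo ≡ T → ∀ j → lo ≤ j → j ≤ hi → f j ≡ f lo
  adjacent-constant _ zero lo≤0 _ = cong f (sym (n≤0⇒n≡0 lo≤0))
  adjacent-constant half (suc j) lo≤sj sj≤hi with m≤n⇒m<n∨m≡n lo≤sj
  ... | inj₂ lo≡sj = cong f (sym lo≡sj)
  ... | inj₁ lo<sj = +-cancelˡ-≡ (f lo) _ _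
    (trans (cong (_+ f (suc j)) (sym fj≡flo)) (trans (adj j lo≤j sj≤hi) (sym half)))
    where
      lo≤j = s≤s⁻¹ lo<sj
      fj≡flo = adjacent-constant half j lo≤j (<⇒≤ sj≤hi)

odd-cycle-halves : ∀ {f T m} → AdjacentSums f T 1 m → f m + f 1 ≡ T
                 → (∃ λ t → m ≡ 2 * t + 1)
                 → ∀ i → 1 ≤ i → i ≤ m → f i + f i ≡ T
odd-cycle-halves {f} {T} adj closing (t , refl) i 1≤i i≤m =
  trans (cong₂ _+_ fi≡f1 fi≡f1) f1-half
  where
    f1-half : f 1 + f 1 ≡ T
    f1-half = trans (cong (_+ f 1) (sym (adjacent-period-2 {f = f} adj t ≤-refl))) closing
    fi≡f1 : f i ≡ f 1
    fi≡f1 = adjacent-constant {f = f} adj f1-half i 1≤i i≤m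

pairSum : (ℕ → ℕ) → ℕ → ℕ
pairSum r j = r j + r (suc j)

oppositeSum : ℕ → (ℕ → ℕ) → ℕ → ℕ
oppositeSum n r j = pairSum r j + pairSum r (n ∸ j)

mirrorSum : ℕ → (ℕ → ℕ) → ℕ → ℕ
mirrorSum n r j = r j + r (suc n ∸ j)

mirrorSum-involutive : ∀ n r {j} → j ≤ suc n → mirrorSum n r (suc n ∸ j) ≡ mirrorSum n r j
mirrorSum-involutive n r {j} j≤sn =
  trans (cong (λ c → r (suc n ∸ j) + r c) (m∸[m∸n]≡n j≤sn)) (+-comm (r (suc n ∸ j)) (r j))

mirrorSum-adjacent : ∀ n r {T} → (∀ j → 1 ≤ j → j < n → oppositeSum n r j ≡ T)
                   → AdjacentSums (mirrorSum n r) T 1 n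
mirrorSum-adjacent n r {T} opposite j 1≤j j<n = begin
    (r j + r (suc n ∸ j)) + (r (suc j) + r (n ∸ j))
  ≡⟨ cong (λ c → (r j + r c) + (r (suc j) + r (n ∸ j))) (+-∸-assoc 1 (<⇒≤ j<n)) ⟩
    (r j + r (suc (n ∸ j))) + (r (suc j) + r (n ∸ j))
  ≡⟨ interchange (r j) (r (suc (n ∸ j))) (r (suc j)) (r (n ∸ j)) ⟩
    pairSum r j + (r (suc (n ∸ j)) + r (n ∸ j))
  ≡⟨ cong (pairSum r j +_) (+-comm (r (suc (n ∸ j))) (r (n ∸ j))) ⟩
    oppositeSum n r j
  ≡⟨ opposite j 1≤j j<n ⟩
    T ∎
  where open ≡-Reasoning

mirrorSum-halves : ∀ {n T} r k → n ≡ k + k → AdjacentSums (mirrorSum n r) T 1 n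
                 → ∀ j → 1 ≤ j → j ≤ n → mirrorSum n r j + mirrorSum n r j ≡ T
mirrorSum-halves _ zero refl _ (suc _) (s≤s z≤n) ()
mirrorSum-halves {n} {T} r k@(suc _) refl adj j 1≤j j≤n =
  trans (cong₂ _+_ (b≡middle j 1≤j j≤n) (b≡middle j 1≤j j≤n)) middle-half
  where
    b = mirrorSum n r
    n∸k≡k : n ∸ k ≡ k
    n∸k≡k = m+n∸n≡m k k
    sn∸k≡sk : suc n ∸ k ≡ suc k
    sn∸k≡sk = trans (+-∸-assoc 1 (m≤m+n k k)) (cong suc n∸k≡k)
    k<n : k < n
    k<n = +-monoˡ-≤ k (s≤s z≤n)
    middle : b k ≡ b (suc k)
    middle = trans (cong (λ c → r k + r c) sn∸k≡sk)
               (trans (+-comm (r k) (r (suc k))) (cong (λ c → r (suc k) + r c) (sym n∸k≡k)))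
    middle-half : b k + b k ≡ T
    middle-half = trans (cong (b k +_) middle) (adj k (s≤s z≤n) k<n)
    upper : ∀ j → k ≤ j → j ≤ n → b j ≡ b k
    upper = adjacent-constant {f = b} (λ j k≤j → adj j (≤-trans (s≤s z≤n) k≤j)) middle-half
    b≡middle : ∀ j → 1 ≤ j → j ≤ n → b j ≡ b k
    b≡middle j 1≤j j≤n with ≤-total k j
    ... | inj₁ k≤j = upper j k≤j j≤n
    ... | inj₂ j≤k = trans (sym (mirrorSum-involutive n r (m≤n⇒m≤1+n j≤n)))
      (upper (suc n ∸ j)
        (≤-trans (≤-trans (n≤1+n k) (≤-reflexive (sym sn∸k≡sk))) (∸-monoʳ-≤ (suc n) j≤k))
        (∸-monoʳ-≤ (suc n) 1≤j))

module _ {m n : ℕ} {x : ℕ → ℕ → ℕ} {S : ℕ} (faces : FacesHaveSum m n x S) where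

  face-pairSums : ∀ {i j} → 1 ≤ i → i < m → 1 ≤ j → j < n
                → pairSum (x i) j + pairSum (x (suc i)) j ≡ S
  face-pairSums {i} {j} 1≤i i<m 1≤j j<n =
    trans (sym (+-assoc (pairSum (x i) j) (x (suc i) j) (x (suc i) (suc j))))
      (subst (λ c → x i j + x i c + x (suc i) j + x (suc i) c ≡ S) (nextCol-< j<n)
        (proj₁ faces i j 1≤i (<⇒≤pred i<m) 1≤j (<⇒≤ j<n)))

  twist-pairSums : ∀ {j} → 1 ≤ j → j < n → pairSum (x m) j + pairSum (x 1) (n ∸ j) ≡ S
  twist-pairSums {j} 1≤j j<n = begin
      pairSum (x m) j + pairSum (x 1) (n ∸ j)
    ≡⟨ cong (pairSum (x m) j +_) (+-comm (x 1 (n ∸ j)) (x 1 (suc (n ∸ j)))) ⟩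
      pairSum (x m) j + (x 1 (suc (n ∸ j)) + x 1 (n ∸ j))
    ≡⟨ sym (+-assoc (pairSum (x m) j) (x 1 (suc (n ∸ j))) (x 1 (n ∸ j))) ⟩
      x m j + x m (suc j) + x 1 (suc (n ∸ j)) + x 1 (n ∸ j)
    ≡⟨ cong (λ c → x m j + x m c + x 1 (suc (n ∸ j)) + x 1 (n ∸ j)) (sym (nextCol-< j<n)) ⟩
      x m j + x m (nextCol n j) + x 1 (suc (n ∸ j)) + x 1 (n ∸ j)
    ≡⟨ cong₂ (λ c c′ → x m j + x m (nextCol n j) + x 1 c + x 1 c′)
         (sym twisted-col) (sym (oppPrevCol-< j<n)) ⟩
      x m j + x m (nextCol n j) + x 1 (n + 1 ∸ j) + x 1 (oppPrevCol n j)
    ≡⟨ proj₂ faces j 1≤j (<⇒≤ j<n) ⟩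
      S ∎
    where
      open ≡-Reasoning
      twisted-col : n + 1 ∸ j ≡ suc (n ∸ j)
      twisted-col = trans (cong (_∸ j) (+-comm n 1)) (+-∸-assoc 1 (<⇒≤ j<n))

  oppositeSum-adjacent : ∀ {j} → 1 ≤ j → j < n → AdjacentSums (λ i → oppositeSum n (x i) j) (S + S) 1 m
  oppositeSum-adjacent {j} 1≤j j<n i 1≤i i<m =
    trans (interchange (pairSum (x i) j) (pairSum (x i) (n ∸ j))
                       (pairSum (x (suc i)) j) (pairSum (x (suc i)) (n ∸ j)))
      (cong₂ _+_ (face-pairSums 1≤i i<m 1≤j j<n)
                 (face-pairSums 1≤i i<m (m<n⇒0<n∸m j<n) (∸-monoʳ-< {o = 0} 1≤j (<⇒≤ j<n))))

  oppositeSum-closing : ∀ {j} → 1 ≤ j → j < n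
                      → oppositeSum n (x m) j + oppositeSum n (x 1) j ≡ S + S
  oppositeSum-closing {j} 1≤j j<n = begin
      (A m j + A m j′) + (A 1 j + A 1 j′)
    ≡⟨ cong ((A m j + A m j′) +_) (+-comm (A 1 j) (A 1 j′)) ⟩
      (A m j + A m j′) + (A 1 j′ + A 1 j)
    ≡⟨ interchange (A m j) (A m j′) (A 1 j′) (A 1 j) ⟩
      (A m j + A 1 j′) + (A m j′ + A 1 j)
    ≡⟨ cong (λ c → (A m j + A 1 j′) + (A m j′ + A 1 c)) (sym (m∸[m∸n]≡n (<⇒≤ j<n))) ⟩
      (A m j + A 1 j′) + (A m j′ + A 1 (n ∸ j′))
    ≡⟨ cong₂ _+_ (twist-pairSums 1≤j j<n)
                 (twist-pairSums (m<n⇒0<n∸m j<n) (∸-monoʳ-< {o = 0} 1≤j (<⇒≤ j<n))) ⟩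
      S + S ∎
    where
      open ≡-Reasoning
      A = λ i → pairSum (x i)
      j′ = n ∸ j

  oppositeSum≡ : (∃ λ t → m ≡ 2 * t + 1)
               → ∀ {i j} → 1 ≤ i → i ≤ m → 1 ≤ j → j < n → oppositeSum n (x i) j ≡ S
  oppositeSum≡ m-odd {i} {j} 1≤i i≤m 1≤j j<n = +-self-injective
    (odd-cycle-halves {f = λ i → oppositeSum n (x i) j}
      (oppositeSum-adjacent 1≤j j<n) (oppositeSum-closing 1≤j j<n) m-odd i 1≤i i≤m)

mirrorSum≡ : ∀ {m n x S} → IsBijectiveLabeling m n x → 1 ≤ m * n
           → (∀ i j → 1 ≤ i → i ≤ m → 1 ≤ j → j ≤ n → mirrorSum n (x i) j + mirrorSum n (x i) j ≡ S)
           → ∀ i j → 1 ≤ i → i ≤ m → 1 ≤ j → j ≤ n → mirrorSum n (x i) j ≡ m * n + 1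
mirrorSum≡ {m} {n} {x} (inRange , _ , onto) 1≤mn halves i j 1≤i i≤m 1≤j j≤n
  with onto 1 ≤-refl 1≤mn | onto (m * n) 1≤mn ≤-refl
... | i₁ , j₁ , 1≤i₁ , i₁≤m , 1≤j₁ , j₁≤n , x≡1
    | iₙ , jₙ , 1≤iₙ , iₙ≤m , 1≤jₙ , jₙ≤n , x≡mn = ≤-antisym upper lower
  where
    open ≤-Reasoning
    mirror-label : ∀ {i′ j′} → 1 ≤ i′ → i′ ≤ m → 1 ≤ j′ → j′ ≤ n
                 → 1 ≤ x i′ (suc n ∸ j′) × x i′ (suc n ∸ j′) ≤ m * n
    mirror-label 1≤i′ i′≤m 1≤j′ j′≤n =
      inRange _ _ 1≤i′ i′≤m (m<n⇒0<n∸m (s≤s j′≤n)) (∸-monoʳ-≤ (suc n) 1≤j′)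
    same : ∀ {i′ j′} → 1 ≤ i′ → i′ ≤ m → 1 ≤ j′ → j′ ≤ n
         → mirrorSum n (x i) j ≡ mirrorSum n (x i′) j′
    same 1≤i′ i′≤m 1≤j′ j′≤n = +-self-injective
      (trans (halves i j 1≤i i≤m 1≤j j≤n) (sym (halves _ _ 1≤i′ i′≤m 1≤j′ j′≤n)))
    upper : mirrorSum n (x i) j ≤ m * n + 1
    upper = begin
      mirrorSum n (x i) j          ≡⟨ same 1≤i₁ i₁≤m 1≤j₁ j₁≤n ⟩
      x i₁ j₁ + x i₁ (suc n ∸ j₁)   ≡⟨ cong (_+ x i₁ (suc n ∸ j₁)) x≡1 ⟩
      1 + x i₁ (suc n ∸ j₁)         ≤⟨ +-monoʳ-≤ 1 (proj₂ (mirror-label 1≤i₁ i₁≤m 1≤j₁ j₁≤n)) ⟩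
      1 + m * n                     ≡⟨ +-comm 1 (m * n) ⟩
      m * n + 1                     ∎
    lower : m * n + 1 ≤ mirrorSum n (x i) j
    lower = begin
      m * n + 1                     ≤⟨ +-monoʳ-≤ (m * n) (proj₁ (mirror-label 1≤iₙ iₙ≤m 1≤jₙ jₙ≤n)) ⟩
      m * n + x iₙ (suc n ∸ jₙ)      ≡⟨ cong (_+ x iₙ (suc n ∸ jₙ)) (sym x≡mn) ⟩
      mirrorSum n (x iₙ) jₙ          ≡⟨ same 1≤iₙ iₙ≤m 1≤jₙ jₙ≤n ⟨
      mirrorSum n (x i) j           ∎

lemma3p2 : (m n : ℕ) → 3 ≤ m → (∃ λ t → m ≡ 2 * t + 1) → 1 ≤ n → (∃ λ k → n ≡ 2 * k)
    → (x : ℕ → ℕ → ℕ) → IsC4FaceMagicKleinLabeling m n x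
    → IsEquatoriallyBalanced m n x
lemma3p2 m n 3≤m m-odd 1≤n (k , n≡2k) x (bijective , S , faces) i j 1≤i i≤m 1≤j 2j≤n =
  trans (cong (λ c → x i j + x i (c ∸ j)) (+-comm n 1))
        (mirrorSum≡ bijective (*-mono-≤ (≤-trans (s≤s z≤n) 3≤m) 1≤n) halves
                    i j 1≤i i≤m 1≤j (≤-trans (m≤m+n j (j + 0)) 2j≤n))
  where
    halves : ∀ i j → 1 ≤ i → i ≤ m → 1 ≤ j → j ≤ n → mirrorSum n (x i) j + mirrorSum n (x i) j ≡ S
    halves i j 1≤i i≤m = mirrorSum-halves (x i) k (trans n≡2k (cong (k +_) (+-identityʳ k)))
      (mirrorSum-adjacent n (x i) λ j′ 1≤j′ j′<n →
        oppositeSum≡ {x = x} faces m-odd 1≤i i≤m 1≤j′ j′<n)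
      j
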